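{- Let $G$ and $H$ be two connected graphs of order $n_1\ge 2$ and $n_2\ge 2$, respectively. Then $$3 \le \dim_l(G\boxtimes H)\le n_1\cdot \dim_l(H) + n_2\cdot \dim_l(G) - \dim_l(G)\cdot \dim_l(H).$$
   Context: All graphs are finite, simple and connected; $d_G(x,y)$ denotes the shortest-path distance in $G$. A vertex $s$ distinguishes vertices $x,y$ if $d_G(s,x)\ne d_G(s,y)$. A set $S\subseteq V(G)$ is a local metric generator for $G$ if every two adjacent vertices of $G$ are distinguished by some vertex of $S$; the local metric dimension $\dim_l(G)$ is the minimum cardinality of a local metric generator. The strong product $G\boxtimes H$ has vertex set $V(G)\times V(H)$, with $(a,b)$ and $(c,d)$ adjacent iff ($a=c$ and $bd\in E(H)$) or ($b=d$ and $ac\in E(G)$) or ($ac\in E(G)$ and $bd\in E(H)$). -}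

module Defs where

open import Data.Nat using (ℕ; zero; suc; _<_; _≤_)
open import Data.Fin using (Fin)
open import Data.Fin.Properties using (*↔×)
open import Data.Product using (_×_; _,_; ∃; ∃-syntax)
open import Data.Sum using (_⊎_; inj₁; inj₂)
open import Data.List using (List; length)
open import Data.List.Relation.Unary.Any using (Any)
open import Data.List.Relation.Unary.Unique.Propositional using (Unique)
open import Function.Bundles using (_↔_)
open import Function.Properties.Inverse using (↔-sym; ↔-trans)
open import Data.Product.Function.NonDependent.Propositional using (_×-↔_)
open import Relation.Nullary using (¬_)
open import Relation.Binary.PropositionalEquality using (_≡_; _≢_; refl; sym)

record Graph : Set₁ where
  field
    V       : Set
    order   : ℕ
    enum    : V ↔ Fin order
    _~_     : V → V → Set
    ~-sym   : ∀ {x y} → x ~ y → y ~ x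
    ~-irr   : ∀ {x} → ¬ (x ~ x)

open Graph public

data Walk (G : Graph) : V G → V G → ℕ → Set where
  here : ∀ {x} → Walk G x x zero
  step : ∀ {x y z k} → _~_ G x y → Walk G y z k → Walk G x z (suc k)

Connected : Graph → Set
Connected G = ∀ (x y : V G) → ∃[ k ] Walk G x y k

Dist : (G : Graph) → V G → V G → ℕ → Set
Dist G x y k = Walk G x y k × (∀ m → m < k → ¬ Walk G x y m)

Distinguishes : (G : Graph) → V G → V G → V G → Set
Distinguishes G s x y = ∀ a b → Dist G s x a → Dist G s y b → a ≢ b

IsLocalMetricGenerator : (G : Graph) → List (V G) → Set
IsLocalMetricGenerator G S =
  ∀ x y → _~_ G x y → Any (λ s → Distinguishes G s x y) S

IsLocalMetricDimension : (G : Graph) → ℕ → Set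
IsLocalMetricDimension G d =
  (∃[ S ] (Unique S × IsLocalMetricGenerator G S × length S ≡ d)) ×
  (∀ S → Unique S → IsLocalMetricGenerator G S → d ≤ length S)

_⊠_ : Graph → Graph → Graph
G ⊠ H = record
  { V = V G × V H
  ; order = order G Data.Nat.* order H
  ; enum = ↔-trans (enum G ×-↔ enum H) (↔-sym *↔×)
  ; _~_ = adj
  ; ~-sym = adj-sym
  ; ~-irr = adj-irr
  }
  where
  adj : V G × V H → V G × V H → Set
  adj (a , b) (c , d) =
    (a ≡ c × _~_ H b d) ⊎ (_~_ G a c × b ≡ d) ⊎ (_~_ G a c × _~_ H b d)
  adj-sym : ∀ {x y} → adj x y → adj y x
  adj-sym (inj₁ (refl , q)) = inj₁ (refl , ~-sym H q)
  adj-sym (inj₂ (inj₁ (p , refl))) = inj₂ (inj₁ (~-sym G p , refl))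
  adj-sym (inj₂ (inj₂ (p , q))) = inj₂ (inj₂ (~-sym G p , ~-sym H q))
  adj-irr : ∀ {x} → ¬ adj x x
  adj-irr (inj₁ (_ , q)) = ~-irr H q
  adj-irr (inj₂ (inj₁ (p , _))) = ~-irr G p
  adj-irr (inj₂ (inj₂ (p , _))) = ~-irr G p

-- Distances in G ⊠ H are the maxima of the coordinate distances. Hence a vertex t of a
-- generator of G distinguishes (a , b) from (c , b) through (t , b), a vertex t of a generator
-- of H distinguishes (a , b) from (a , e) through (a , t), and (V G × S_H) ∪ (S_G × V H) is a
-- local metric generator of G ⊠ H, of size n₁ dim H + n₂ dim G − dim G · dim H.
-- For the lower bound, every vertex s = (u , v) of G ⊠ H spans a K₄ with (u , v′), (u′ , v),
-- (u′ , v′) for neighbours u′ of u and v′ of v. A vertex never distinguishes two of its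
-- neighbours, and no vertex distinguishes all three pairs of a triangle, since its distances to
-- the three corners are pairwise at most one apart. So a generator containing s needs two more
-- vertices to distinguish the edges of the triangle opposite s.
module Submission where

open import Defs
open import Data.Nat using (ℕ; zero; suc; _+_; _*_; _∸_; _⊔_; _≤_; _<_; z≤n; s≤s; _≤?_)
open import Data.Nat.Properties hiding (_≟_)
open import Data.Fin using (fromℕ<) renaming (_≟_ to _≟Fin_)
open import Data.Fin.Properties using (fromℕ<-injective)
open import Data.Product using (_×_; _,_; proj₁; proj₂; ∃-syntax; ∃₂)
open import Data.Sum using (_⊎_; inj₁; inj₂)
import Data.Sum as Sum
open import Data.Empty using (⊥; ⊥-elim)
open import Data.List using (List; []; _∷_; length; map; filter; cartesianProduct; allFin; _++_)
open import Data.List.Properties using (length-map; length-++; length-tabulate)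
open import Data.List.Relation.Unary.Any as Any using (Any)
import Data.List.Relation.Unary.All as All
import Data.List.Relation.Unary.AllPairs as AllPairs
open import Data.List.Relation.Unary.Unique.Propositional using (Unique)
open import Data.List.Relation.Unary.Unique.Propositional.Properties
  using (++⁺; cartesianProduct⁺; filter⁺; map⁺; allFin⁺)
open import Data.List.Membership.Propositional using (_∈_; find; lose)
open import Data.List.Membership.Propositional.Properties
  using (∈-map⁺; ∈-allFin; ∈-++⁺ˡ; ∈-++⁺ʳ; ∈-cartesianProduct⁺; ∈-cartesianProduct⁻; ∈-filter⁺; ∈-filter⁻)
import Data.List.Membership.DecPropositional as DecMembership
open import Function using (_∘′_)
open import Function.Bundles using (Inverse; Injection)
open import Function.Properties.Inverse using (↔⇒↣; ↔-sym)
open import Relation.Nullary using (¬_; Dec; yes; no; ¬?)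
open import Relation.Nullary.Decidable using (map′)
open import Relation.Binary.Definitions using (DecidableEquality)
open import Relation.Binary.PropositionalEquality

≢-within-one⇒differ-by-one : ∀ {a b} → a ≤ suc b → b ≤ suc a → a ≢ b → a ≡ suc b ⊎ b ≡ suc a
≢-within-one⇒differ-by-one {zero}        {zero}        _ _ a≢b = ⊥-elim (a≢b refl)
≢-within-one⇒differ-by-one {zero}        {suc zero}    _ _ _ = inj₂ refl
≢-within-one⇒differ-by-one {zero}        {suc (suc b)} _ (s≤s ()) _
≢-within-one⇒differ-by-one {suc zero}    {zero}        _ _ _ = inj₁ refl
≢-within-one⇒differ-by-one {suc (suc a)} {zero}        (s≤s ()) _ _
≢-within-one⇒differ-by-one {suc a}       {suc b}       (s≤s a≤) (s≤s b≤) a≢b =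
  Sum.map (cong suc) (cong suc) (≢-within-one⇒differ-by-one a≤ b≤ (a≢b ∘′ cong suc))

¬three-distinct-within-one : ∀ {a b c} →
  a ≤ suc b → b ≤ suc a → a ≤ suc c → c ≤ suc a → b ≤ suc c → c ≤ suc b →
  a ≢ b → a ≢ c → b ≢ c → ⊥
¬three-distinct-within-one ab ba ac ca bc cb a≢b a≢c b≢c
  with ≢-within-one⇒differ-by-one ab ba a≢b
     | ≢-within-one⇒differ-by-one ac ca a≢c
     | ≢-within-one⇒differ-by-one bc cb b≢c
... | inj₁ refl | inj₁ b+1≡c+1 | _         = b≢c (suc-injective b+1≡c+1)
... | inj₂ refl | inj₂ c≡a+1   | _         = b≢c (sym c≡a+1)
... | inj₁ refl | inj₂ refl    | inj₁ ()
... | inj₁ refl | inj₂ refl    | inj₂ ()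
... | inj₂ refl | inj₁ refl    | inj₁ ()
... | inj₂ refl | inj₁ refl    | inj₂ ()

-- n₁ * dH + dG * f counts V G × S_H and S_G × (V H ∖ S_H), where f = |V H ∖ S_H|.
generator-size-bound : ∀ n₁ n₂ dG dH f → dH + f ≤ n₂ →
  n₁ * dH + dG * f ≤ (n₁ * dH + n₂ * dG) ∸ dG * dH
generator-size-bound n₁ n₂ dG dH f dH+f≤n₂ = begin
    n₁ * dH + dG * f
  ≤⟨ +-monoʳ-≤ (n₁ * dH) (*-monoʳ-≤ dG (m+n≤o⇒m≤o∸n f (subst (_≤ n₂) (+-comm dH f) dH+f≤n₂))) ⟩
    n₁ * dH + dG * (n₂ ∸ dH)
  ≡⟨ cong (n₁ * dH +_) (*-distribˡ-∸ dG n₂ dH) ⟩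
    n₁ * dH + (dG * n₂ ∸ dG * dH)
  ≡⟨ +-∸-assoc (n₁ * dH) (*-monoʳ-≤ dG (≤-trans (m≤m+n dH f) dH+f≤n₂)) ⟨
    (n₁ * dH + dG * n₂) ∸ dG * dH
  ≡⟨ cong (λ m → (n₁ * dH + m) ∸ dG * dH) (*-comm dG n₂) ⟩
    (n₁ * dH + n₂ * dG) ∸ dG * dH ∎
  where open ≤-Reasoning

module _ {A : Set} where

  remove : ∀ {x : A} {ys} → x ∈ ys → List A
  remove {ys = _ ∷ ys} (Any.here _)  = ys
  remove {ys = y ∷ _}  (Any.there p) = y ∷ remove p

  length-remove : ∀ {x : A} {ys} (p : x ∈ ys) → length ys ≡ suc (length (remove p))
  length-remove (Any.here _)  = refl
  length-remove (Any.there p) = cong suc (length-remove p)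

  ∈-remove : ∀ {x y : A} {ys} (p : x ∈ ys) → y ∈ ys → y ≢ x → y ∈ remove p
  ∈-remove (Any.here refl) (Any.here refl) y≢x = ⊥-elim (y≢x refl)
  ∈-remove (Any.here refl) (Any.there q)   _   = q
  ∈-remove (Any.there p)   (Any.here refl) _   = Any.here refl
  ∈-remove (Any.there p)   (Any.there q)   y≢x = Any.there (∈-remove p q y≢x)

  Unique-⊆⇒length-≤ : ∀ {xs ys : List A} → Unique xs → (∀ {z} → z ∈ xs → z ∈ ys) →
                      length xs ≤ length ys
  Unique-⊆⇒length-≤ AllPairs.[] _ = z≤n
  Unique-⊆⇒length-≤ {x ∷ xs} {ys} (x∉xs AllPairs.∷ xs!) xs⊆ys =
    subst (suc (length xs) ≤_) (sym (length-remove x∈ys))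
      (s≤s (Unique-⊆⇒length-≤ xs! λ z∈xs →
        ∈-remove x∈ys (xs⊆ys (Any.there z∈xs)) λ z≡x → All.lookup x∉xs z∈xs (sym z≡x)))
    where x∈ys = xs⊆ys (Any.here refl)

  3≤length-of-distinct : ∀ {xs : List A} {a b c} → Unique xs → a ∈ xs → b ∈ xs → c ∈ xs →
                         a ≢ b → a ≢ c → b ≢ c → 3 ≤ length xs
  3≤length-of-distinct {a = a} {b} {c} _ a∈ b∈ c∈ a≢b a≢c b≢c = Unique-⊆⇒length-≤ abc! abc⊆
    where
    abc! : Unique (a ∷ b ∷ c ∷ [])
    abc! = (a≢b All.∷ a≢c All.∷ All.[]) AllPairs.∷ (b≢c All.∷ All.[]) AllPairs.∷ All.[] AllPairs.∷ AllPairs.[]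
    abc⊆ : ∀ {z} → z ∈ a ∷ b ∷ c ∷ [] → z ∈ _
    abc⊆ (Any.here refl)                         = a∈
    abc⊆ (Any.there (Any.here refl))             = b∈
    abc⊆ (Any.there (Any.there (Any.here refl))) = c∈

length-cartesianProduct : ∀ {A B : Set} (xs : List A) (ys : List B) →
                          length (cartesianProduct xs ys) ≡ length xs * length ys
length-cartesianProduct []       ys = refl
length-cartesianProduct (x ∷ xs) ys =
  trans (length-++ (map (x ,_) ys)) (cong₂ _+_ (length-map (x ,_) ys) (length-cartesianProduct xs ys))

module Vertices (K : Graph) where
  open Inverse (enum K)

  _≟_ : DecidableEquality (V K)
  x ≟ y = map′ (Injection.injective (↔⇒↣ (enum K))) (cong to) (to x ≟Fin to y)

  from-injective : ∀ {i j} → from i ≡ from j → i ≡ j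
  from-injective = Injection.injective (↔⇒↣ (↔-sym (enum K)))

  vertices : List (V K)
  vertices = map from (allFin (order K))

  ∈-vertices : ∀ x → x ∈ vertices
  ∈-vertices x = subst (_∈ vertices) (strictlyInverseʳ x) (∈-map⁺ from (∈-allFin (to x)))

  length-vertices : length vertices ≡ order K
  length-vertices = trans (length-map from (allFin _)) (length-tabulate _)

  vertices! : Unique vertices
  vertices! = map⁺ from-injective (allFin⁺ _)

  two-distinct-vertices : 2 ≤ order K → ∃₂ λ v w → v ≢ w
  two-distinct-vertices 2≤n =
    from (fromℕ< {0} (≤-trans (s≤s z≤n) 2≤n)) , from (fromℕ< {1} 2≤n) ,
    λ eq → 0≢1+n (fromℕ<-injective 0 1 _ _ (from-injective eq))

module Distance (K : Graph) where

  walk-snoc : ∀ {x y z k} → Walk K x y k → _~_ K y z → Walk K x z (suc k)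
  walk-snoc here       e = step e here
  walk-snoc (step e w) f = step e (walk-snoc w f)

  walk-zero⇒≡ : ∀ {x y} → Walk K x y 0 → x ≡ y
  walk-zero⇒≡ here = refl

  first-step : ∀ {x y k} → x ≢ y → Walk K x y k → ∃[ z ] _~_ K x z
  first-step x≢x here       = ⊥-elim (x≢x refl)
  first-step _   (step e _) = _ , e

  dist-minimal : ∀ {x y a j} → Dist K x y a → Walk K x y j → a ≤ j
  dist-minimal {a = a} {j} (_ , shortest) w with a ≤? j
  ... | yes a≤j = a≤j
  ... | no  a≰j = ⊥-elim (shortest j (≰⇒> a≰j) w)

  dist-unique : ∀ {x y a b} → Dist K x y a → Dist K x y b → a ≡ b
  dist-unique da db = ≤-antisym (dist-minimal da (proj₁ db)) (dist-minimal db (proj₁ da))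

  dist-refl : ∀ {x} → Dist K x x 0
  dist-refl = here , λ _ ()

  dist-zero⇒≡ : ∀ {x y} → Dist K x y 0 → x ≡ y
  dist-zero⇒≡ d = walk-zero⇒≡ (proj₁ d)

  dist-adjacent : ∀ {x y} → _~_ K x y → Dist K x y 1
  dist-adjacent {x} e = step e here , λ where
    zero    _        w → ~-irr K (subst (_~_ K x) (sym (walk-zero⇒≡ w)) e)
    (suc _) (s≤s ()) _

  dist-along-edge : ∀ {s x y a b} → Dist K s x a → Dist K s y b → _~_ K x y → b ≤ suc a
  dist-along-edge dx dy e = dist-minimal dy (walk-snoc (proj₁ dx) e)

  private
    no-short-walk : ∀ {x y} → ¬ (∃[ k ] Dist K x y k) → ∀ n m → m < n → ¬ Walk K x y m
    no-short-walk no-dist (suc n) m m<1+n w with m<1+n⇒m<n∨m≡n m<1+n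
    ... | inj₁ m<n  = no-short-walk no-dist n m m<n w
    ... | inj₂ refl = no-dist (m , w , no-short-walk no-dist m)

  -- Constructively a shortest walk is only obtained up to double negation, which suffices
  -- because Distinguishes is itself a negation.
  ¬¬dist : Connected K → ∀ x y → ¬ ¬ (∃[ k ] Dist K x y k)
  ¬¬dist connected x y no-dist =
    no-short-walk no-dist (suc (proj₁ (connected x y))) _ (n<1+n _) (proj₂ (connected x y))

  neighbour-distinguishes-self : ∀ {s x} → _~_ K x s → Distinguishes K s x s
  neighbour-distinguishes-self {s} {x} x~s a b da db a≡b =
    ~-irr K (subst (_~_ K x) (dist-zero⇒≡ (subst (Dist K s x) (trans a≡b (dist-unique db dist-refl)) da)) x~s)

  ¬distinguishes-neighbours : ∀ {s x y} → _~_ K s x → _~_ K s y → ¬ Distinguishes K s x y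
  ¬distinguishes-neighbours s~x s~y D = D 1 1 (dist-adjacent s~x) (dist-adjacent s~y) refl

  common-neighbour≢distinguisher : ∀ {s t x y} → _~_ K s x → _~_ K s y → Distinguishes K t x y → s ≢ t
  common-neighbour≢distinguisher s~x s~y D refl = ¬distinguishes-neighbours s~x s~y D

  ¬distinguishes-triangle : Connected K → ∀ {t x y z} → _~_ K x y → _~_ K x z → _~_ K y z →
    Distinguishes K t x y → Distinguishes K t x z → Distinguishes K t y z → ⊥
  ¬distinguishes-triangle connected {t} {x} {y} {z} x~y x~z y~z Dxy Dxz Dyz =
    ¬¬dist connected t x λ (a , da) → ¬¬dist connected t y λ (b , db) → ¬¬dist connected t z λ (c , dc) →
      ¬three-distinct-within-one
        (dist-along-edge db da (~-sym K x~y)) (dist-along-edge da db x~y)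
        (dist-along-edge dc da (~-sym K x~z)) (dist-along-edge da dc x~z)
        (dist-along-edge dc db (~-sym K y~z)) (dist-along-edge db dc y~z)
        (Dxy a b da db) (Dxz a c da dc) (Dyz b c db dc)

has-neighbour : (K : Graph) → 2 ≤ order K → Connected K → ∀ u → ∃[ y ] _~_ K u y
has-neighbour K 2≤n connected u with Vertices.two-distinct-vertices K 2≤n
... | v , w , v≢w with Vertices._≟_ K u v
...   | no  u≢v  = Distance.first-step K u≢v (proj₂ (connected u v))
...   | yes refl = Distance.first-step K v≢w (proj₂ (connected u w))

has-edge : (K : Graph) → 2 ≤ order K → Connected K → ∃₂ (_~_ K)
has-edge K 2≤n connected with v , _ ← Vertices.two-distinct-vertices K 2≤n = v , has-neighbour K 2≤n connected v

record K₄ (K : Graph) (s : V K) : Set where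
  field
    {x y z} : V K
    s~x : _~_ K s x
    s~y : _~_ K s y
    s~z : _~_ K s z
    x~y : _~_ K x y
    x~z : _~_ K x z
    y~z : _~_ K y z

module _ (K : Graph) (connected : Connected K) {s} (k₄ : K₄ K s) where
  open Distance K
  open Vertices K using (_≟_)
  open K₄ k₄

  K₄⇒3≤generator : ∀ {S} → s ∈ S → Unique S → IsLocalMetricGenerator K S → 3 ≤ length S
  K₄⇒3≤generator s∈S S! generates
    with find (generates x y x~y) | find (generates x z x~z) | find (generates y z y~z)
  ... | t₁ , t₁∈S , D₁ | t₂ , t₂∈S , D₂ | t₃ , t₃∈S , D₃ with t₁ ≟ t₂ | t₁ ≟ t₃
  ...   | no t₁≢t₂ | _        = 3≤length-of-distinct S! s∈S t₁∈S t₂∈S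
    (common-neighbour≢distinguisher s~x s~y D₁) (common-neighbour≢distinguisher s~x s~z D₂) t₁≢t₂
  ...   | yes refl | no t₁≢t₃ = 3≤length-of-distinct S! s∈S t₁∈S t₃∈S
    (common-neighbour≢distinguisher s~x s~y D₁) (common-neighbour≢distinguisher s~y s~z D₃) t₁≢t₃
  ...   | yes refl | yes refl = ⊥-elim (¬distinguishes-triangle connected x~y x~z y~z D₁ D₂ D₃)

module StrongProduct (G H : Graph) where

  walk-proj₁ : ∀ {p q k} → Walk (G ⊠ H) p q k → ∃[ j ] (j ≤ k × Walk G (proj₁ p) (proj₁ q) j)
  walk-proj₁ here = 0 , z≤n , here
  walk-proj₁ (step (inj₁ (refl , _)) w) with j , j≤k , w′ ← walk-proj₁ w = j , m≤n⇒m≤1+n j≤k , w′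
  walk-proj₁ (step (inj₂ (inj₁ (e , _))) w) with j , j≤k , w′ ← walk-proj₁ w = suc j , s≤s j≤k , step e w′
  walk-proj₁ (step (inj₂ (inj₂ (e , _))) w) with j , j≤k , w′ ← walk-proj₁ w = suc j , s≤s j≤k , step e w′

  walk-proj₂ : ∀ {p q k} → Walk (G ⊠ H) p q k → ∃[ j ] (j ≤ k × Walk H (proj₂ p) (proj₂ q) j)
  walk-proj₂ here = 0 , z≤n , here
  walk-proj₂ (step (inj₁ (_ , e)) w) with j , j≤k , w′ ← walk-proj₂ w = suc j , s≤s j≤k , step e w′
  walk-proj₂ (step (inj₂ (inj₁ (_ , refl))) w) with j , j≤k , w′ ← walk-proj₂ w = j , m≤n⇒m≤1+n j≤k , w′
  walk-proj₂ (step (inj₂ (inj₂ (_ , e))) w) with j , j≤k , w′ ← walk-proj₂ w = suc j , s≤s j≤k , step e w′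

  walk-liftˡ : ∀ {x u y k} → Walk G x u k → Walk (G ⊠ H) (x , y) (u , y) k
  walk-liftˡ here       = here
  walk-liftˡ (step e w) = step (inj₂ (inj₁ (e , refl))) (walk-liftˡ w)

  walk-liftʳ : ∀ {x y v k} → Walk H y v k → Walk (G ⊠ H) (x , y) (x , v) k
  walk-liftʳ here       = here
  walk-liftʳ (step e w) = step (inj₁ (refl , e)) (walk-liftʳ w)

  walk-pair : ∀ {x u y v α β} → Walk G x u α → Walk H y v β → Walk (G ⊠ H) (x , y) (u , v) (α ⊔ β)
  walk-pair here       w′          = walk-liftʳ w′
  walk-pair (step e w) here        = walk-liftˡ (step e w)
  walk-pair (step e w) (step f w′) = step (inj₂ (inj₂ (e , f))) (walk-pair w w′)

  ⊠-connected : Connected G → Connected H → Connected (G ⊠ H)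
  ⊠-connected cG cH (x , y) (u , v) = _ , walk-pair (proj₂ (cG x u)) (proj₂ (cH y v))

  ⊠-dist≡⊔ : ∀ {x u y v α β p} → Dist G x u α → Dist H y v β → Dist (G ⊠ H) (x , y) (u , v) p →
             p ≡ α ⊔ β
  ⊠-dist≡⊔ dα dβ dp = ≤-antisym
    (dist-minimal (G ⊠ H) dp (walk-pair (proj₁ dα) (proj₁ dβ)))
    (⊔-lub (let j , j≤p , w = walk-proj₁ (proj₁ dp) in ≤-trans (dist-minimal G dα w) j≤p)
           (let j , j≤p , w = walk-proj₂ (proj₁ dp) in ≤-trans (dist-minimal H dβ w) j≤p))
    where open Distance using (dist-minimal)

  module _ (cG : Connected G) (cH : Connected H) where
    open Distance using (¬¬dist; dist-unique; dist-refl; dist-adjacent; dist-zero⇒≡)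

    ⊠-distinguishes-by-⊔ : ∀ {t s a b c e} →
      (∀ {α β α′ β′} → Dist G t a α → Dist H s b β → Dist G t c α′ → Dist H s e β′ → α ⊔ β ≢ α′ ⊔ β′) →
      Distinguishes (G ⊠ H) (t , s) (a , b) (c , e)
    ⊠-distinguishes-by-⊔ {t} {s} {a} {b} {c} {e} ⊔≢ p q dp dq p≡q =
      ¬¬dist G cG t a λ (_ , dα) → ¬¬dist H cH s b λ (_ , dβ) →
      ¬¬dist G cG t c λ (_ , dα′) → ¬¬dist H cH s e λ (_ , dβ′) →
      ⊔≢ dα dβ dα′ dβ′ (trans (sym (⊠-dist≡⊔ dα dβ dp)) (trans p≡q (⊠-dist≡⊔ dα′ dβ′ dq)))

    ⊠-distinguishesʳ : ∀ {a t b e} → Distinguishes H t b e → Distinguishes (G ⊠ H) (a , t) (a , b) (a , e)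
    ⊠-distinguishesʳ D = ⊠-distinguishes-by-⊔ λ dα dβ dα′ dβ′ →
      D _ _ dβ dβ′ ∘′ ⊔-cancel (dist-unique G (dist-refl G) dα) (dist-unique G (dist-refl G) dα′)
      where
      ⊔-cancel : ∀ {α α′ β β′} → 0 ≡ α → 0 ≡ α′ → α ⊔ β ≡ α′ ⊔ β′ → β ≡ β′
      ⊔-cancel refl refl eq = eq

    ⊠-distinguishesˡ : ∀ {b t a c} → Distinguishes G t a c → Distinguishes (G ⊠ H) (t , b) (a , b) (c , b)
    ⊠-distinguishesˡ D = ⊠-distinguishes-by-⊔ λ dα dβ dα′ dβ′ →
      D _ _ dα dα′ ∘′ ⊔-cancel (dist-unique H (dist-refl H) dβ) (dist-unique H (dist-refl H) dβ′)
      where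
      ⊔-cancel : ∀ {α α′ β β′} → 0 ≡ β → 0 ≡ β′ → α ⊔ β ≡ α′ ⊔ β′ → α ≡ α′
      ⊔-cancel {α} {α′} refl refl = subst₂ _≡_ (⊔-identityʳ α) (⊔-identityʳ α′)

    ⊠-distinguishes-diagonal : ∀ {b e t a c} → _~_ H b e → t ≢ c → Distinguishes G t a c →
                               Distinguishes (G ⊠ H) (t , b) (a , b) (c , e)
    ⊠-distinguishes-diagonal b~e t≢c D = ⊠-distinguishes-by-⊔ λ dα dβ dα′ dβ′ →
      D _ _ dα dα′ ∘′ ⊔-cancel (dist-unique H (dist-refl H) dβ) (dist-unique H (dist-adjacent H b~e) dβ′)
                               (1≤dist dα′)
      where
      1≤dist : ∀ {α′} → Dist G _ _ α′ → 1 ≤ α′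
      1≤dist {zero}  d = ⊥-elim (t≢c (dist-zero⇒≡ G d))
      1≤dist {suc _} _ = s≤s z≤n
      ⊔-cancel : ∀ {α α′ β β′} → 0 ≡ β → 1 ≡ β′ → 1 ≤ α′ → α ⊔ β ≡ α′ ⊔ β′ → α ≡ α′
      ⊔-cancel {α} {α′} refl refl 1≤α′ = subst₂ _≡_ (⊔-identityʳ α) (m≥n⇒m⊔n≡m 1≤α′)

  ⊠-K₄ : (∀ u → ∃[ u′ ] _~_ G u u′) → (∀ v → ∃[ v′ ] _~_ H v v′) → ∀ u v → K₄ (G ⊠ H) (u , v)
  ⊠-K₄ G-neighbour H-neighbour u v with u′ , u~u′ ← G-neighbour u | v′ , v~v′ ← H-neighbour v = record
    { x = u , v′ ; y = u′ , v ; z = u′ , v′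
    ; s~x = inj₁ (refl , v~v′)
    ; s~y = inj₂ (inj₁ (u~u′ , refl))
    ; s~z = inj₂ (inj₂ (u~u′ , v~v′))
    ; x~y = inj₂ (inj₂ (u~u′ , ~-sym H v~v′))
    ; x~z = inj₂ (inj₁ (u~u′ , refl))
    ; y~z = inj₁ (refl , v~v′)
    }

module ProductGenerator (G H : Graph) (SG : List (V G)) (SH : List (V H)) where
  open StrongProduct G H
  open Vertices using (vertices; ∈-vertices; vertices!; length-vertices)
  open DecMembership (Vertices._≟_ H) using (_∈?_)

  ∉SH? : ∀ h → Dec (¬ h ∈ SH)
  ∉SH? h = ¬? (h ∈? SH)

  outside-SH : List (V H)
  outside-SH = filter ∉SH? (vertices H)

  generator : List (V G × V H)
  generator = cartesianProduct (vertices G) SH ++ cartesianProduct SG outside-SH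

  ∈-generatorʳ : ∀ {g h} → h ∈ SH → (g , h) ∈ generator
  ∈-generatorʳ {g} h∈SH = ∈-++⁺ˡ (∈-cartesianProduct⁺ (∈-vertices G g) h∈SH)

  ∈-generatorˡ : ∀ {g h} → g ∈ SG → (g , h) ∈ generator
  ∈-generatorˡ {h = h} g∈SG with h ∈? SH
  ... | yes h∈SH = ∈-generatorʳ h∈SH
  ... | no  h∉SH = ∈-++⁺ʳ _ (∈-cartesianProduct⁺ g∈SG (∈-filter⁺ ∉SH? (∈-vertices H h) h∉SH))

  generator-generates : Connected G → Connected H →
    IsLocalMetricGenerator G SG → IsLocalMetricGenerator H SH → IsLocalMetricGenerator (G ⊠ H) generator
  generator-generates cG cH G-gen H-gen (a , b) (.a , e) (inj₁ (refl , b~e))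
    with t , t∈SH , D ← find (H-gen b e b~e) = lose (∈-generatorʳ t∈SH) (⊠-distinguishesʳ cG cH D)
  generator-generates cG cH G-gen H-gen (a , b) (c , .b) (inj₂ (inj₁ (a~c , refl)))
    with t , t∈SG , D ← find (G-gen a c a~c) = lose (∈-generatorˡ t∈SG) (⊠-distinguishesˡ cG cH D)
  generator-generates cG cH G-gen H-gen (a , b) (c , e) (inj₂ (inj₂ (a~c , b~e)))
    with t , t∈SG , D ← find (G-gen a c a~c) | Vertices._≟_ G t c
  ... | yes refl = lose (∈-generatorˡ t∈SG)
                        (Distance.neighbour-distinguishes-self (G ⊠ H) (inj₂ (inj₂ (a~c , b~e))))
  ... | no  t≢c  = lose (∈-generatorˡ t∈SG) (⊠-distinguishes-diagonal cG cH b~e t≢c D)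

  outside-SH! : Unique outside-SH
  outside-SH! = filter⁺ ∉SH? (vertices! H)

  SH-disjoint-outside-SH : ∀ {h} → ¬ (h ∈ SH × h ∈ outside-SH)
  SH-disjoint-outside-SH (h∈SH , h∈outside) = proj₂ (∈-filter⁻ ∉SH? {xs = vertices H} h∈outside) h∈SH

  generator! : Unique SG → Unique SH → Unique generator
  generator! SG! SH! = ++⁺ (cartesianProduct⁺ (vertices! G) SH!) (cartesianProduct⁺ SG! outside-SH!)
    λ (p∈ˡ , p∈ʳ) → SH-disjoint-outside-SH
      (proj₂ (∈-cartesianProduct⁻ (vertices G) SH p∈ˡ) , proj₂ (∈-cartesianProduct⁻ SG outside-SH p∈ʳ))

  length-generator : length generator ≡ order G * length SH + length SG * length outside-SH
  length-generator = trans (length-++ (cartesianProduct (vertices G) SH)) (cong₂ _+_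
    (trans (length-cartesianProduct (vertices G) SH) (cong (_* length SH) (length-vertices G)))
    (length-cartesianProduct SG outside-SH))

  length-SH+outside-SH≤order : Unique SH → length SH + length outside-SH ≤ order H
  length-SH+outside-SH≤order SH! = subst₂ _≤_ (length-++ SH) (length-vertices H)
    (Unique-⊆⇒length-≤ (++⁺ SH! outside-SH! SH-disjoint-outside-SH) λ {h} _ → ∈-vertices H h)

  length-generator≤ : Unique SH →
    length generator ≤ (order G * length SH + order H * length SG) ∸ length SG * length SH
  length-generator≤ SH! = ≤-trans (≤-reflexive length-generator)
    (generator-size-bound (order G) (order H) (length SG) (length SH) _ (length-SH+outside-SH≤order SH!))

module _ (G H : Graph) (2≤n₁ : 2 ≤ order G) (2≤n₂ : 2 ≤ order H) (cG : Connected G) (cH : Connected H) where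
  open StrongProduct G H

  ⊠-3≤generator : ∀ {S} → Unique S → IsLocalMetricGenerator (G ⊠ H) S → 3 ≤ length S
  ⊠-3≤generator S! generates
    with g , _ ← Vertices.two-distinct-vertices G 2≤n₁ | h , h′ , h~h′ ← has-edge H 2≤n₂ cH
    with (u , v) , s∈S , _ ← find (generates (g , h) (g , h′) (inj₁ (refl , h~h′))) =
    K₄⇒3≤generator (G ⊠ H) (⊠-connected cG cH)
      (⊠-K₄ (has-neighbour G 2≤n₁ cG) (has-neighbour H 2≤n₂ cH) u v) s∈S S! generates

theorem4 : (G H : Graph) → 2 ≤ order G → 2 ≤ order H →
    Connected G → Connected H →
    (dG dH d : ℕ) →
    IsLocalMetricDimension G dG → IsLocalMetricDimension H dH →
    IsLocalMetricDimension (G ⊠ H) d →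
    3 ≤ d × d ≤ (order G * dH + order H * dG) ∸ dG * dH
theorem4 G H 2≤n₁ 2≤n₂ cG cH dG dH d
         ((SG , SG! , G-gen , refl) , _) ((SH , SH! , H-gen , refl) , _) ((S , S! , gen , refl) , minimal) =
  ⊠-3≤generator G H 2≤n₁ 2≤n₂ cG cH S! gen ,
  ≤-trans (minimal generator (generator! SG! SH!) (generator-generates cG cH G-gen H-gen))
          (length-generator≤ SH!)
  where open ProductGenerator G H SG SH
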